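{- Let $p,q$ be integers with $1<p<q$ and $\gcd(p,q)=1$. Let $m_1<m_2<\cdots$ be the increasing enumeration of all integers of the form $p^xq^y$ with $x,y\in\mathbb{Z}_{\ge0}$, where $m_i=p^{x_i}q^{y_i}$. For $t\ge1$ let $f(t)$ be the maximal cardinality of a $\{p,q\}$-quotient-free subset of $\{m_1,\ldots,m_t\}$, and for $j\in\{0,1\}$ let $A_j(t)=\{m_i:1\le i\le t,\ x_i+y_i\equiv j\pmod 2\}$. Then for every $t\ge1$, $$f(t)=\max\big(|A_0(t)|,|A_1(t)|\big).$$
   Context: A set $S$ of positive integers is $\{p,q\}$-quotient-free if there are no $x,y\in S$ with $x/y\in\{p,q\}$. Since $\gcd(p,q)=1$ and $p,q>1$, the exponents $x_i,y_i$ are uniquely determined by $m_i$. -}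

module Defs where

open import Data.Nat using (ℕ; _+_; _*_; _^_; _%_; _<_; _⊔_)
open import Data.Nat.Properties using (_≟_)
open import Data.Fin using (Fin; toℕ)
open import Data.Fin.Subset using (Subset; _∈_; ∣_∣)
open import Data.Vec using (tabulate)
open import Data.Product using (Σ; ∃; _×_)
open import Relation.Nullary using (¬_; does)
open import Relation.Binary.PropositionalEquality using (_≡_)

-- m : ℕ → ℕ is the increasing enumeration, with m i = m_{i+1} (0-based index);
-- x i, y i are its exponents: m i = p^(x i) * q^(y i).
IsEnumeration : (p q : ℕ) (m x y : ℕ → ℕ) → Set
IsEnumeration p q m x y =
  (∀ i → m i < m (Data.Nat.suc i)) ×
  (∀ i → m i ≡ p ^ x i * q ^ y i) ×
  (∀ a b → ∃ λ i → m i ≡ p ^ a * q ^ b)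

QuotientFree : (p q : ℕ) (m : ℕ → ℕ) (t : ℕ) → Subset t → Set
QuotientFree p q m t S =
  ∀ (u v : Fin t) → u ∈ S → v ∈ S →
    ¬ (m (toℕ u) ≡ p * m (toℕ v)) × ¬ (m (toℕ u) ≡ q * m (toℕ v))

A : (x y : ℕ → ℕ) (j t : ℕ) → Subset t
A x y j t = tabulate (λ i → does (((x (toℕ i) + y (toℕ i)) % 2) ≟ j))

module Submission where

-- Writing the numbers p ^ a * q ^ b as cells (a , b) of the plane ℕ × ℕ, the first
-- t terms of the enumeration form a Young diagram (column a holds the cells below
-- m t), quotient-free subsets become independent sets of cells (no two sharing an
-- edge), and A₀(t), A₁(t) are the two colour classes of the diagonal colouring
-- (a , b) ↦ (a + b) mod 2.  The upper bound is therefore the combinatorial fact that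
-- an independent set in a Young diagram is no larger than its larger colour class.
-- It is proved by induction on the size of the diagram: a nonempty diagram either
-- has a removable domino (losing one cell of each colour and at most one cell of the
-- independent set), or is a staircase, whose outermost corner has the strict majority
-- colour.  The lower bound holds because each colour class is itself quotient-free.

open import Defs
open import Data.Nat using (ℕ; _<_; _≤_; _⊔_)
open import Data.Nat.GCD using (gcd)
open import Data.Fin.Subset using (Subset; ∣_∣)
open import Data.Product using (Σ; ∃; _×_)
open import Relation.Binary.PropositionalEquality using (_≡_)

open import Data.Nat using (zero; suc; _+_; _*_; _^_; _∸_; _%_; pred; NonZero; z≤n; s≤s; s≤s⁻¹; z<s; >-nonZero)
open import Data.Nat.Properties
open import Data.Bool using (Bool; true; false)
open import Data.Fin using (toℕ; zero; suc)
open import Data.Fin.Properties using (toℕ-injective; any?)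
open import Data.Fin.Subset using (_∈_)
open import Data.Fin.Subset.Properties using (_∈?_)
open import Data.Vec using ([]; _∷_; lookup)
open import Data.Vec.Properties using (lookup∘tabulate; lookup⇒[]=; []=⇒lookup)
open import Relation.Nullary.Decidable using (_×-dec_)
open import Data.Product using (_,_; proj₁; proj₂)
open import Data.Sum using (_⊎_; inj₁; inj₂)
open import Relation.Binary.Definitions using (tri<; tri≈; tri>)
open import Data.Empty using (⊥-elim)
open import Function using (_∘_)
open import Relation.Nullary using (Dec; yes; no; ¬_; does)
open import Relation.Binary.PropositionalEquality
  using (refl; sym; trans; cong; cong₂; subst; subst₂; _≢_; module ≡-Reasoning)
open import Data.Nat.Divisibility using (_∣_; ∣1⇒≡1; m∣m*n)
open import Data.Nat.Coprimality using (Coprime; coprime-divisor; gcd≡1⇒coprime)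
open import Algebra.Properties.CommutativeSemigroup *-commutativeSemigroup
  using (x∙yz≈y∙xz)
open import Algebra.Properties.CommutativeSemigroup +-commutativeSemigroup
  using (interchange)

open ≡-Reasoning

sum< : ℕ → (ℕ → ℕ) → ℕ
sum< zero    g = 0
sum< (suc n) g = sum< n g + g n

syntax sum< n (λ i → g) = ∑[ i < n ] g

sum-cong : ∀ n {f g : ℕ → ℕ} → (∀ i → i < n → f i ≡ g i) → sum< n f ≡ sum< n g
sum-cong zero    eq = refl
sum-cong (suc n) eq = cong₂ _+_ (sum-cong n (λ i i<n → eq i (m<n⇒m<1+n i<n))) (eq n ≤-refl)

sum-const : ∀ n c → ∑[ i < n ] c ≡ n * c
sum-const zero    c = refl
sum-const (suc n) c = trans (cong (_+ c) (sum-const n c)) (+-comm (n * c) c)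

sum-zero : ∀ n {g : ℕ → ℕ} → (∀ i → i < n → g i ≡ 0) → sum< n g ≡ 0
sum-zero n eq = trans (sum-cong n eq) (trans (sum-const n 0) (*-zeroʳ n))

sum-head : ∀ n (g : ℕ → ℕ) → sum< (suc n) g ≡ g 0 + ∑[ i < n ] g (suc i)
sum-head zero    g = +-comm 0 (g 0)
sum-head (suc n) g = begin
  sum< (suc n) g + g (suc n)             ≡⟨ cong (_+ g (suc n)) (sum-head n g) ⟩
  g 0 + ∑[ i < n ] g (suc i) + g (suc n) ≡⟨ +-assoc (g 0) _ _ ⟩
  g 0 + ∑[ i < suc n ] g (suc i)         ∎

sum-update : ∀ n a₀ {f g : ℕ → ℕ} e → a₀ < n → (∀ a → a ≢ a₀ → f a ≡ g a) →
             f a₀ ≡ g a₀ + e → sum< n f ≡ sum< n g + e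
sum-update (suc n) a₀ {f} {g} e a₀<1+n off at with a₀ ≟ n
... | yes refl = begin
  sum< n f + f a₀       ≡⟨ cong₂ _+_ (sum-cong n (λ i i<n → off i (<⇒≢ i<n))) at ⟩
  sum< n g + (g a₀ + e) ≡⟨ +-assoc (sum< n g) (g a₀) e ⟨
  sum< n g + g a₀ + e   ∎
... | no a₀≢n = begin
  sum< n f + f n       ≡⟨ cong₂ _+_ (sum-update n a₀ e a₀<n off at) (off n (a₀≢n ∘ sym)) ⟩
  sum< n g + e + g n   ≡⟨ +-assoc (sum< n g) e (g n) ⟩
  sum< n g + (e + g n) ≡⟨ cong (sum< n g +_) (+-comm e (g n)) ⟩
  sum< n g + (g n + e) ≡⟨ +-assoc (sum< n g) (g n) e ⟨
  sum< n g + g n + e   ∎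
  where
  a₀<n : a₀ < n
  a₀<n = ≤∧≢⇒< (s≤s⁻¹ a₀<1+n) a₀≢n

bit : Bool → ℕ
bit true  = 1
bit false = 0

indicator : ∀ {P : Set} → Dec P → ℕ
indicator d = bit (does d)

indicator-yes : ∀ {P : Set} (d : Dec P) → P → indicator d ≡ 1
indicator-yes (yes _) _ = refl
indicator-yes (no ¬p) p = ⊥-elim (¬p p)

indicator-no : ∀ {P : Set} (d : Dec P) → ¬ P → indicator d ≡ 0
indicator-no (yes p) ¬p = ⊥-elim (¬p p)
indicator-no (no _)  _  = refl

indicator≤1 : ∀ {P : Set} (d : Dec P) → indicator d ≤ 1
indicator≤1 (yes _) = ≤-refl
indicator≤1 (no _)  = z≤n

indicator-exclusive : ∀ {P Q : Set} (d : Dec P) (e : Dec Q) → (P → ¬ Q) →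
                      indicator d + indicator e ≤ 1
indicator-exclusive (yes p) (yes q) excl = ⊥-elim (excl p q)
indicator-exclusive (yes _) (no _)  _    = ≤-refl
indicator-exclusive (no _)  e       _    = indicator≤1 e

record Alternating (κ κ' : ℕ → ℕ) : Set where
  field
    complement : ∀ n → κ n + κ' n ≡ 1
    shift      : ∀ n → κ (suc n) ≡ κ' n
    shift'     : ∀ n → κ' (suc n) ≡ κ n

swap : ∀ {κ κ'} → Alternating κ κ' → Alternating κ' κ
swap {κ} {κ'} alt = record
  { complement = λ n → trans (+-comm (κ' n) (κ n)) (complement n)
  ; shift      = shift'
  ; shift'     = shift
  }
  where open Alternating alt

residue : ℕ → ℕ → ℕ
residue c N = indicator (N % 2 ≟ c)

residue-alternating : Alternating (residue 0) (residue 1)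
residue-alternating = record { complement = complement ; shift = shift ; shift' = shift' }
  where
  complement : ∀ n → residue 0 n + residue 1 n ≡ 1
  complement 0             = refl
  complement 1             = refl
  complement (suc (suc n)) = complement n
  shift : ∀ n → residue 0 (suc n) ≡ residue 1 n
  shift 0             = refl
  shift 1             = refl
  shift (suc (suc n)) = shift n
  shift' : ∀ n → residue 1 (suc n) ≡ residue 0 n
  shift' 0             = refl
  shift' 1             = refl
  shift' (suc (suc n)) = shift' n

alternating-exclusive : ∀ {κ κ' n} → Alternating κ κ' → κ n ≡ 1 → κ' n ≡ 0
alternating-exclusive {κ} {κ'} {n} alt κn≡1 =
  +-cancelˡ-≡ 1 (κ' n) 0 (trans (cong (_+ κ' n) (sym κn≡1)) (Alternating.complement alt n))

sum≡1 : ∀ {u v} → u + v ≡ 1 → (u ≡ 1 × v ≡ 0) ⊎ (u ≡ 0 × v ≡ 1)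
sum≡1 {0}             refl = inj₂ (refl , refl)
sum≡1 {1}             refl = inj₁ (refl , refl)
sum≡1 {suc (suc _)}   ()

diag : (ℕ → ℕ) → ℕ → ℕ → ℕ
diag κ a b = κ (a + b)

data Adjacent : ℕ → ℕ → ℕ → ℕ → Set where
  horizontal : ∀ a b → Adjacent a b (suc a) b
  vertical   : ∀ a b → Adjacent a b a (suc b)

domino-colour : ∀ {κ κ'} → Alternating κ κ' →
                ∀ {a b a' b'} → Adjacent a b a' b' → diag κ a b + diag κ a' b' ≡ 1
domino-colour {κ} {κ'} alt (horizontal a b) = begin
  κ (a + b) + κ (suc (a + b)) ≡⟨ cong (κ (a + b) +_) (shift (a + b)) ⟩
  κ (a + b) + κ' (a + b)      ≡⟨ complement (a + b) ⟩
  1                           ∎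
  where open Alternating alt
domino-colour {κ} alt (vertical a b) = begin
  κ (a + b) + κ (a + suc b)   ≡⟨ cong (λ c → κ (a + b) + κ c) (+-suc a b) ⟩
  κ (a + b) + κ (suc (a + b)) ≡⟨ domino-colour alt (horizontal a b) ⟩
  1                           ∎

-- Young diagrams.  A function h : ℕ → ℕ is read as the column heights of the set
-- of cells {(a , b) | b < h a}; weight n h F is the total of F over its first n columns.
weight : ℕ → (ℕ → ℕ) → (ℕ → ℕ → ℕ) → ℕ
weight n h F = ∑[ a < n ] sum< (h a) (F a)

size : ℕ → (ℕ → ℕ) → ℕ
size n h = weight n h (λ _ _ → 1)

record Young (n : ℕ) (h : ℕ → ℕ) : Set where
  field
    nonincreasing : ∀ a → h (suc a) ≤ h a
    empty-at      : h n ≡ 0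

  antitone : ∀ {a b} → a ≤ b → h b ≤ h a
  antitone {a} {b} a≤b with m≤n⇒m<n∨m≡n a≤b
  ... | inj₂ refl = ≤-refl
  antitone {a} {suc b} a≤b | inj₁ a<1+b = ≤-trans (nonincreasing b) (antitone (s≤s⁻¹ a<1+b))

  nonempty-column : ∀ {a} → 0 < h a → a < n
  nonempty-column {a} 0<ha with a <? n
  ... | yes a<n = a<n
  ... | no  a≮n = ⊥-elim (<⇒≢ (≤-trans 0<ha (subst (h a ≤_) empty-at (antitone (≮⇒≥ a≮n)))) refl)

weight-cong : ∀ n {h h' : ℕ → ℕ} (F : ℕ → ℕ → ℕ) → (∀ a → h a ≡ h' a) → weight n h F ≡ weight n h' F
weight-cong n F eq = sum-cong n (λ a _ → cong (λ k → sum< k (F a)) (eq a))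

weight-empty : ∀ n {h : ℕ → ℕ} (F : ℕ → ℕ → ℕ) → (∀ a → h a ≡ 0) → weight n h F ≡ 0
weight-empty n F eq = sum-zero n (λ a _ → cong (λ k → sum< k (F a)) (eq a))

weight-head : ∀ n (h : ℕ → ℕ) F →
              weight (suc n) h F ≡ sum< (h 0) (F 0) + weight n (h ∘ suc) (F ∘ suc)
weight-head n h F = sum-head n (λ a → sum< (h a) (F a))

lower : (ℕ → ℕ) → ℕ → ℕ → ℕ
lower h a a' with a' ≟ a
... | yes _ = pred (h a)
... | no  _ = h a'

lower-at : ∀ h a → lower h a a ≡ pred (h a)
lower-at h a with a ≟ a
... | yes _   = refl
... | no  a≢a = ⊥-elim (a≢a refl)

lower-off : ∀ h a {a'} → a' ≢ a → lower h a a' ≡ h a'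
lower-off h a {a'} a'≢a with a' ≟ a
... | yes a'≡a = ⊥-elim (a'≢a a'≡a)
... | no  _    = refl

module _ {n : ℕ} {h : ℕ → ℕ} (young : Young n h) {a : ℕ} (corner : h (suc a) < h a) where
  open Young young

  private
    a<n : a < n
    a<n = nonempty-column (≤-trans (s≤s z≤n) corner)

  lower-young : Young n (lower h a)
  lower-young = record { nonincreasing = nonincreasing' ; empty-at = empty-at' }
    where
    nonincreasing' : ∀ a' → lower h a (suc a') ≤ lower h a a'
    nonincreasing' a' = by-cases (a' ≟ a) (suc a' ≟ a)
      where
      by-cases : Dec (a' ≡ a) → Dec (suc a' ≡ a) → lower h a (suc a') ≤ lower h a a'
      by-cases (yes refl) _ = subst₂ _≤_ (sym (lower-off h a (<⇒≢ (n<1+n a) ∘ sym)))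
                                        (sym (lower-at h a)) (<⇒≤pred corner)
      by-cases (no a'≢a) (yes refl) = subst₂ _≤_ (sym (lower-at h a)) (sym (lower-off h a a'≢a))
                                                (≤-trans pred[n]≤n (nonincreasing a'))
      by-cases (no a'≢a) (no 1+a'≢a) = subst₂ _≤_ (sym (lower-off h a 1+a'≢a))
                                                 (sym (lower-off h a a'≢a)) (nonincreasing a')
    empty-at' : lower h a n ≡ 0
    empty-at' = trans (lower-off h a (<⇒≢ a<n ∘ sym)) empty-at

  lower-weight : ∀ F → weight n h F ≡ weight n (lower h a) F + F a (pred (h a))
  lower-weight F = sum-update n a (F a (pred (h a))) a<n
    (λ a' a'≢a → cong (λ k → sum< k (F a')) (sym (lower-off h a a'≢a)))
    (begin
      sum< (h a) (F a)                                 ≡⟨ top-cell (h a) (≤-trans (s≤s z≤n) corner) ⟩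
      sum< (pred (h a)) (F a) + F a (pred (h a))       ≡⟨ cong (λ k → sum< k (F a) + F a (pred (h a))) (lower-at h a) ⟨
      sum< (lower h a a) (F a) + F a (pred (h a))      ∎)
    where
    top-cell : ∀ k → 0 < k → sum< k (F a) ≡ sum< (pred k) (F a) + F a (pred k)
    top-cell (suc k) _ = refl

staircase : ℕ → ℕ → ℕ
staircase k a = k ∸ a

staircase-peel : ∀ n k F → k < n →
  weight n (staircase (suc k)) F ≡ weight n (staircase k) F + ∑[ a < suc k ] F a (k ∸ a)
staircase-peel (suc n) zero F _ = begin
  weight (suc n) (staircase 1) F                           ≡⟨ weight-head n (staircase 1) F ⟩
  F 0 0 + weight n (staircase 0) (F ∘ suc)                 ≡⟨ cong (F 0 0 +_) (weight-empty n (F ∘ suc) 0∸n≡0) ⟩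
  F 0 0 + 0                                                ≡⟨ +-comm (F 0 0) 0 ⟩
  0 + F 0 0                                                ≡⟨ cong (_+ F 0 0) (weight-empty (suc n) F 0∸n≡0) ⟨
  weight (suc n) (staircase 0) F + ∑[ a < 1 ] F a (0 ∸ a)  ∎
staircase-peel (suc n) (suc k) F (s≤s k<n) = begin
  weight (suc n) (staircase (2 + k)) F
    ≡⟨ weight-head n (staircase (2 + k)) F ⟩
  sum< (2 + k) (F 0) + weight n (staircase (suc k)) (F ∘ suc)
    ≡⟨ cong (sum< (2 + k) (F 0) +_) (staircase-peel n k (F ∘ suc) k<n) ⟩
  (sum< (suc k) (F 0) + F 0 (suc k)) + (weight n (staircase k) (F ∘ suc) + ∑[ a < suc k ] F (suc a) (k ∸ a))
    ≡⟨ interchange (sum< (suc k) (F 0)) (F 0 (suc k)) _ _ ⟩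
  (sum< (suc k) (F 0) + weight n (staircase k) (F ∘ suc)) + (F 0 (suc k) + ∑[ a < suc k ] F (suc a) (k ∸ a))
    ≡⟨ cong₂ _+_ (weight-head n (staircase (suc k)) F) (sum-head (suc k) (λ a → F a (suc k ∸ a))) ⟨
  weight (suc n) (staircase (suc k)) F + ∑[ a < 2 + k ] F a (suc k ∸ a)
    ∎

staircase-count : ℕ → ℕ → (ℕ → ℕ) → ℕ
staircase-count n k κ = weight n (staircase k) (diag κ)

-- Each diagonal is monochromatic, so adding the diagonal a + b = k adds k + 1 cells of its colour.
staircase-count-suc : ∀ n k κ → k < n → staircase-count n (suc k) κ ≡ staircase-count n k κ + suc k * κ k
staircase-count-suc n k κ k<n =
  trans (staircase-peel n k (diag κ) k<n) (cong (staircase-count n k κ +_) diagonal)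
  where
  diagonal : ∑[ a < suc k ] κ (a + (k ∸ a)) ≡ suc k * κ k
  diagonal = trans (sum-cong (suc k) (λ a a≤k → cong κ (m+[n∸m]≡n (s≤s⁻¹ a≤k))))
                   (sum-const (suc k) (κ k))

staircase-count-add : ∀ n k χ → k < n → χ k ≡ 1 → staircase-count n (suc k) χ ≡ staircase-count n k χ + suc k
staircase-count-add n k χ k<n χk≡1 = begin
  staircase-count n (suc k) χ         ≡⟨ staircase-count-suc n k χ k<n ⟩
  staircase-count n k χ + suc k * χ k ≡⟨ cong (λ c → staircase-count n k χ + suc k * c) χk≡1 ⟩
  staircase-count n k χ + suc k * 1   ≡⟨ cong (staircase-count n k χ +_) (*-identityʳ (suc k)) ⟩
  staircase-count n k χ + suc k       ∎

staircase-count-skip : ∀ n k χ → k < n → χ k ≡ 0 → staircase-count n (suc k) χ ≡ staircase-count n k χ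
staircase-count-skip n k χ k<n χk≡0 = begin
  staircase-count n (suc k) χ         ≡⟨ staircase-count-suc n k χ k<n ⟩
  staircase-count n k χ + suc k * χ k ≡⟨ cong (λ c → staircase-count n k χ + suc k * c) χk≡0 ⟩
  staircase-count n k χ + suc k * 0   ≡⟨ cong (staircase-count n k χ +_) (*-zeroʳ (suc k)) ⟩
  staircase-count n k χ + 0           ≡⟨ +-identityʳ (staircase-count n k χ) ⟩
  staircase-count n k χ               ∎

staircase-balance : ∀ n k → k ≤ n → ∀ {κ κ'} → Alternating κ κ' → κ k ≡ 1 →
  staircase-count n k κ ≤ staircase-count n k κ' × staircase-count n k κ' ≤ staircase-count n k κ + k
staircase-balance n zero _ {κ} {κ'} _ _ = subst₂ (λ u v → u ≤ v × v ≤ u + 0) (sym (empty κ)) (sym (empty κ'))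
                                                 (z≤n , z≤n)
  where
  empty : ∀ χ → staircase-count n 0 χ ≡ 0
  empty χ = weight-empty n (diag χ) 0∸n≡0
staircase-balance n (suc k) k<n {κ} {κ'} alt κ[1+k]≡1 =
  subst₂ (λ u v → u ≤ v × v ≤ u + suc k)
         (sym (staircase-count-skip n k κ k<n κk≡0)) (sym (staircase-count-add n k κ' k<n κ'k≡1))
         (≤-trans more-κ (+-monoʳ-≤ (count κ') (n≤1+n k)) , +-monoˡ-≤ (suc k) fewer-κ')
  where
  count : (ℕ → ℕ) → ℕ
  count = staircase-count n k
  κ'k≡1 : κ' k ≡ 1
  κ'k≡1 = trans (sym (Alternating.shift alt k)) κ[1+k]≡1
  κk≡0 : κ k ≡ 0
  κk≡0 = alternating-exclusive (swap alt) κ'k≡1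
  fewer-κ' : count κ' ≤ count κ
  fewer-κ' = proj₁ (staircase-balance n k (≤-trans (n≤1+n k) k<n) (swap alt) κ'k≡1)
  more-κ : count κ ≤ count κ' + k
  more-κ = proj₂ (staircase-balance n k (≤-trans (n≤1+n k) k<n) (swap alt) κ'k≡1)

staircase-majority : ∀ n k → k < n → ∀ {κ κ'} → Alternating κ κ' → κ k ≡ 1 →
                     staircase-count n (suc k) κ' < staircase-count n (suc k) κ
staircase-majority n k k<n {κ} {κ'} alt κk≡1 =
  subst₂ _<_ (sym (staircase-count-skip n k κ' k<n (alternating-exclusive alt κk≡1)))
             (sym (staircase-count-add n k κ k<n κk≡1))
             (≤-<-trans (proj₂ (staircase-balance n k (<⇒≤ k<n) alt κk≡1))
                        (+-monoʳ-< (staircase-count n k κ) (n<1+n k)))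

step-size : ∀ {x y} → x ≤ y → y ≡ x ⊎ y ≡ suc x ⊎ 2 + x ≤ y
step-size {y = zero}        z≤n       = inj₁ refl
step-size {y = suc zero}    z≤n       = inj₂ (inj₁ refl)
step-size {y = suc (suc y)} z≤n       = inj₂ (inj₂ (s≤s (s≤s z≤n)))
step-size                   (s≤s x≤y) with step-size x≤y
... | inj₁ y≡x          = inj₁ (cong suc y≡x)
... | inj₂ (inj₁ y≡1+x) = inj₂ (inj₁ (cong suc y≡1+x))
... | inj₂ (inj₂ 2+x≤y) = inj₂ (inj₂ (s≤s 2+x≤y))

-- The three shapes a nonempty Young diagram can have: a column at least two cells
-- taller than the next one (its top two cells form a removable vertical domino), two
-- equal columns followed by a shorter one (their top cells form a removable horizontal
-- domino), or a staircase.
data Shape (h : ℕ → ℕ) : Set where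
  vertical-corner   : ∀ a → 2 + h (suc a) ≤ h a → Shape h
  horizontal-corner : ∀ a → h (suc a) ≡ h a → h (suc (suc a)) < h (suc a) → Shape h
  staircase-shape   : ∀ k → (∀ a → h a ≡ staircase (suc k) a) → Shape h

shape-single-column : ∀ {n h} → Young n h → 0 < h 0 → h 1 ≡ 0 → Shape h
shape-single-column {h = h} young 0<h0 h1≡0 with step-size (Young.nonincreasing young 0)
... | inj₁ h0≡h1          = ⊥-elim (<⇒≢ 0<h0 (sym (trans h0≡h1 h1≡0)))
... | inj₂ (inj₁ h0≡1+h1) = staircase-shape 0 column
  where
  column : ∀ a → h a ≡ 1 ∸ a
  column zero    = trans h0≡1+h1 (cong suc h1≡0)
  column (suc a) = trans (n≤0⇒n≡0 (subst (h (suc a) ≤_) h1≡0 (Young.antitone young (s≤s z≤n))))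
                         (sym (0∸n≡0 a))
... | inj₂ (inj₂ tall)    = vertical-corner 0 tall

shape-extend : ∀ {h} → h 1 ≤ h 0 → Shape (h ∘ suc) → Shape h
shape-extend _ (vertical-corner a tall)             = vertical-corner (suc a) tall
shape-extend _ (horizontal-corner a equal shorter)  = horizontal-corner (suc a) equal shorter
shape-extend {h} h1≤h0 (staircase-shape k stairs) with step-size h1≤h0
... | inj₁ h0≡h1          = horizontal-corner 0 (sym h0≡h1)
                              (subst₂ _<_ (sym (stairs 1)) (sym (stairs 0)) (n<1+n k))
... | inj₂ (inj₁ h0≡1+h1) = staircase-shape (suc k) column
  where
  column : ∀ a → h a ≡ staircase (2 + k) a
  column zero    = trans h0≡1+h1 (cong suc (stairs 0))
  column (suc a) = stairs a
... | inj₂ (inj₂ tall)    = vertical-corner 0 tall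

shape : ∀ n h → Young n h → 0 < h 0 → Shape h
shape zero    h young 0<h0 = ⊥-elim (<⇒≢ 0<h0 (sym (Young.empty-at young)))
shape (suc n) h young 0<h0 with h 1 ≟ 0
... | yes h1≡0 = shape-single-column young 0<h0 h1≡0
... | no  h1≢0 = shape-extend (Young.nonincreasing young 0)
                   (shape n (h ∘ suc) tail (n≢0⇒n>0 h1≢0))
  where
  tail : Young n (h ∘ suc)
  tail = record { nonincreasing = Young.nonincreasing young ∘ suc ; empty-at = Young.empty-at young }

record Independent (s : ℕ → ℕ → ℕ) : Set where
  field
    at-most-one : ∀ a b → s a b ≤ 1
    no-domino   : ∀ {a b a' b'} → Adjacent a b a' b' → s a b + s a' b' ≤ 1

-- The arithmetic behind removing a domino: the independent set loses at most one cell,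
-- each colour class exactly one.
domino-step : ∀ {S S' d X X' Y Y'} → S ≡ S' + d → d ≤ 1 → X ≡ X' + 1 → Y ≡ Y' + 1 →
              S' ≤ X' ⊔ Y' → S ≤ X ⊔ Y
domino-step {S' = S'} {d} {X' = X'} {Y' = Y'} refl d≤1 refl refl S'≤ =
  subst (S' + d ≤_) (+-distribʳ-⊔ 1 X' Y') (+-mono-≤ S'≤ d≤1)

-- The arithmetic behind removing one cell of the strict majority colour.
corner-step : ∀ {S S' d X X' Y Y'} → S ≡ S' + d → d ≤ 1 → X ≡ X' + 1 → Y ≡ Y' → Y < X →
              S' ≤ X' ⊔ Y' → S ≤ X ⊔ Y
corner-step {S' = S'} {d} {X} {X'} {Y' = Y'} refl d≤1 refl refl Y'<X S'≤ =
  ≤-trans (+-mono-≤ (subst (S' ≤_) (m≥n⇒m⊔n≡m Y'≤X') S'≤) d≤1) (m≤m⊔n X Y')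
  where
  Y'≤X' : Y' ≤ X'
  Y'≤X' = s≤s⁻¹ (subst (Y' <_) (+-comm X' 1) Y'<X)

corner-step' : ∀ {S S' d X X' Y Y'} → S ≡ S' + d → d ≤ 1 → X ≡ X' → Y ≡ Y' + 1 → X < Y →
               S' ≤ X' ⊔ Y' → S ≤ X ⊔ Y
corner-step' {X = X} {X'} {Y} {Y'} eqS d≤1 eqX eqY X<Y S'≤ =
  subst (_ ≤_) (⊔-comm Y X) (corner-step eqS d≤1 eqY eqX X<Y (subst (_ ≤_) (⊔-comm X' Y') S'≤))

module IndependenceBound {κ κ' : ℕ → ℕ} (alt : Alternating κ κ')
                         {s : ℕ → ℕ → ℕ} (indep : Independent s) (n : ℕ) where
  open Independent indep

  Bound : (ℕ → ℕ) → Set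
  Bound h = weight n h s ≤ weight n h (diag κ) ⊔ weight n h (diag κ')

  record Reduction (h : ℕ → ℕ) : Set where
    field
      smaller       : ℕ → ℕ
      smaller-young : Young n smaller
      shrinks       : size n smaller < size n h
      lift          : Bound smaller → Bound h

  domino-reduction : ∀ {h h' a b a' b'} → Young n h' → Adjacent a b a' b' →
                     (∀ F → weight n h F ≡ weight n h' F + (F a b + F a' b')) → Reduction h
  domino-reduction {h} {h'} young' adjacent split = record
    { smaller       = h'
    ; smaller-young = young'
    ; shrinks       = subst (size n h' <_) (sym (split (λ _ _ → 1))) (m<m+n (size n h') z<s)
    ; lift          = domino-step (split s) (no-domino adjacent) (colour alt) (colour (swap alt))
    }
    where
    colour : ∀ {χ χ'} → Alternating χ χ' → weight n h (diag χ) ≡ weight n h' (diag χ) + 1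
    colour {χ} alt' = trans (split (diag χ))
                            (cong (weight n h' (diag χ) +_) (domino-colour alt' adjacent))

  vertical-reduction : ∀ {h a} → Young n h → 2 + h (suc a) ≤ h a → Reduction h
  vertical-reduction {h} {a} young tall =
    domino-reduction (lower-young young₁ corner₁) (vertical a b) split
    where
    corner : h (suc a) < h a
    corner = ≤-trans (n≤1+n _) tall
    young₁ : Young n (lower h a)
    young₁ = lower-young young corner
    corner₁ : lower h a (suc a) < lower h a a
    corner₁ = subst₂ _<_ (sym (lower-off h a (<⇒≢ (n<1+n a) ∘ sym))) (sym (lower-at h a))
                         (<⇒≤pred tall)
    b : ℕ
    b = pred (pred (h a))
    top : pred (h a) ≡ suc b
    top = sym (suc-pred (pred (h a)) {{>-nonZero (≤-trans (s≤s z≤n) (<⇒≤pred tall))}})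
    split : ∀ F → weight n h F ≡ weight n (lower (lower h a) a) F + (F a b + F a (suc b))
    split F = begin
      weight n h F
        ≡⟨ lower-weight young corner F ⟩
      weight n (lower h a) F + F a (pred (h a))
        ≡⟨ cong (_+ F a (pred (h a))) (lower-weight young₁ corner₁ F) ⟩
      weight n (lower (lower h a) a) F + F a (pred (lower h a a)) + F a (pred (h a))
        ≡⟨ cong (λ c → weight n (lower (lower h a) a) F + F a (pred c) + F a (pred (h a))) (lower-at h a) ⟩
      weight n (lower (lower h a) a) F + F a b + F a (pred (h a))
        ≡⟨ +-assoc (weight n (lower (lower h a) a) F) (F a b) _ ⟩
      weight n (lower (lower h a) a) F + (F a b + F a (pred (h a)))
        ≡⟨ cong (λ c → weight n (lower (lower h a) a) F + (F a b + F a c)) top ⟩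
      weight n (lower (lower h a) a) F + (F a b + F a (suc b))
        ∎

  horizontal-reduction : ∀ {h a} → Young n h → h (suc a) ≡ h a → h (suc (suc a)) < h (suc a) → Reduction h
  horizontal-reduction {h} {a} young equal corner =
    domino-reduction (lower-young young₁ corner₁) (horizontal a b) split
    where
    b : ℕ
    b = pred (h (suc a))
    h₁ : ℕ → ℕ
    h₁ = lower h (suc a)
    young₁ : Young n h₁
    young₁ = lower-young young corner
    h₁a≡h[1+a] : h₁ a ≡ h (suc a)
    h₁a≡h[1+a] = trans (lower-off h (suc a) (<⇒≢ (n<1+n a))) (sym equal)
    corner₁ : h₁ (suc a) < h₁ a
    corner₁ = subst₂ _<_ (sym (lower-at h (suc a))) (sym h₁a≡h[1+a])
                     (subst (b <_) (suc-pred (h (suc a)) {{>-nonZero (≤-trans (s≤s z≤n) corner)}}) (n<1+n b))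
    split : ∀ F → weight n h F ≡ weight n (lower h₁ a) F + (F a b + F (suc a) b)
    split F = begin
      weight n h F                                      ≡⟨ lower-weight young corner F ⟩
      weight n h₁ F + F (suc a) b                       ≡⟨ cong (_+ F (suc a) b) (lower-weight young₁ corner₁ F) ⟩
      weight n (lower h₁ a) F + F a (pred (h₁ a)) + F (suc a) b
        ≡⟨ cong (λ c → weight n (lower h₁ a) F + F a (pred c) + F (suc a) b) h₁a≡h[1+a] ⟩
      weight n (lower h₁ a) F + F a b + F (suc a) b     ≡⟨ +-assoc (weight n (lower h₁ a) F) (F a b) _ ⟩
      weight n (lower h₁ a) F + (F a b + F (suc a) b)   ∎

  -- The corner cell (k , 0) of a staircase: its colour is the strict majority.
  staircase-reduction : ∀ {h} k → Young n h → (∀ a → h a ≡ staircase (suc k) a) → Reduction h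
  staircase-reduction {h} k young stairs = record
    { smaller       = lower h k
    ; smaller-young = lower-young young corner
    ; shrinks       = subst (size n (lower h k) <_) (sym (split (λ _ _ → 1))) (m<m+n _ z<s)
    ; lift          = lift
    }
    where
    corner : h (suc k) < h k
    corner = subst₂ _<_ (sym (trans (stairs (suc k)) (n∸n≡0 k))) (sym (trans (stairs k) (m+n∸n≡m 1 k)))
                        z<s
    k<n : k < n
    k<n = Young.nonempty-column young (≤-trans z<s corner)
    split : ∀ F → weight n h F ≡ weight n (lower h k) F + F k 0
    split F = trans (lower-weight young corner F)
                    (cong (λ c → weight n (lower h k) F + F k (pred c)) (trans (stairs k) (m+n∸n≡m 1 k)))
    colour : ∀ χ {c} → χ k ≡ c → weight n h (diag χ) ≡ weight n (lower h k) (diag χ) + c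
    colour χ χk≡c = trans (split (diag χ))
                          (cong (weight n (lower h k) (diag χ) +_) (trans (cong χ (+-identityʳ k)) χk≡c))
    count : ∀ χ → weight n h (diag χ) ≡ staircase-count n (suc k) χ
    count χ = weight-cong n (diag χ) stairs
    majority : ∀ {χ χ'} → Alternating χ χ' → χ k ≡ 1 → weight n h (diag χ') < weight n h (diag χ)
    majority {χ} {χ'} alt' χk≡1 =
      subst₂ _<_ (sym (count χ')) (sym (count χ)) (staircase-majority n k k<n alt' χk≡1)
    lift : Bound (lower h k) → Bound h
    lift with sum≡1 (Alternating.complement alt k)
    ... | inj₁ (κk≡1 , κ'k≡0) = corner-step (split s) (at-most-one k 0) (colour κ κk≡1)
                                  (trans (colour κ' κ'k≡0) (+-identityʳ _)) (majority alt κk≡1)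
    ... | inj₂ (κk≡0 , κ'k≡1) = corner-step' (split s) (at-most-one k 0)
                                  (trans (colour κ κk≡0) (+-identityʳ _)) (colour κ' κ'k≡1)
                                  (majority (swap alt) κ'k≡1)

  reduce : ∀ {h} → Young n h → 0 < h 0 → Reduction h
  reduce {h} young 0<h0 with shape n h young 0<h0
  ... | vertical-corner a tall            = vertical-reduction young tall
  ... | horizontal-corner a equal shorter = horizontal-reduction young equal shorter
  ... | staircase-shape k stairs          = staircase-reduction k young stairs

  bound : ∀ N {h} → Young n h → size n h ≤ N → Bound h
  bound N {h} young small with h 0 ≟ 0
  ... | yes h0≡0 = subst (_≤ _) (sym (weight-empty n s empty)) z≤n
    where
    empty : ∀ a → h a ≡ 0
    empty a = n≤0⇒n≡0 (subst (h a ≤_) h0≡0 (Young.antitone young z≤n))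
  bound zero    young small | no h0≢0 = ⊥-elim (n≮0 (≤-trans shrinks small))
    where open Reduction (reduce young (n≢0⇒n>0 h0≢0))
  bound (suc N) young small | no h0≢0 = lift (bound N smaller-young (s≤s⁻¹ (≤-trans shrinks small)))
    where open Reduction (reduce young (n≢0⇒n>0 h0≢0))

  independence-bound : ∀ {h} → Young n h → Bound h
  independence-bound {h} young = bound (size n h) young ≤-refl

module StrictlyIncreasing {f : ℕ → ℕ} (increasing : ∀ {i j} → i < j → f i < f j) where

  monotone : ∀ {i j} → i ≤ j → f i ≤ f j
  monotone i≤j with m≤n⇒m<n∨m≡n i≤j
  ... | inj₁ i<j  = <⇒≤ (increasing i<j)
  ... | inj₂ refl = ≤-refl

  injective : ∀ {i j} → f i ≡ f j → i ≡ j
  injective {i} {j} fi≡fj with <-cmp i j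
  ... | tri< i<j _ _ = ⊥-elim (<⇒≢ (increasing i<j) fi≡fj)
  ... | tri≈ _ i≡j _ = i≡j
  ... | tri> _ _ j<i = ⊥-elim (<⇒≢ (increasing j<i) (sym fi≡fj))

  reflects-≤ : ∀ {i j} → f i ≤ f j → i ≤ j
  reflects-≤ fi≤fj = ≮⇒≥ (λ j<i → <⇒≱ (increasing j<i) fi≤fj)

  reflects-< : ∀ {i j} → f i < f j → i < j
  reflects-< fi<fj = ≰⇒> (λ j≤i → <⇒≱ fi<fj (monotone j≤i))

  ≥-identity : ∀ i → i ≤ f i
  ≥-identity zero    = z≤n
  ≥-identity (suc i) = ≤-<-trans (≥-identity i) (increasing (n<1+n i))

increasing-by-steps : ∀ {f : ℕ → ℕ} → (∀ i → f i < f (suc i)) → ∀ {i j} → i < j → f i < f j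
increasing-by-steps step {i} {suc j} i<1+j with m≤n⇒m<n∨m≡n (s≤s⁻¹ i<1+j)
... | inj₁ i<j  = <-trans (increasing-by-steps step i<j) (step j)
... | inj₂ refl = step j

subset-size : ∀ {t} (S : Subset t) (G : ℕ → ℕ) → (∀ i → bit (lookup S i) ≡ G (toℕ i)) →
              ∣ S ∣ ≡ ∑[ i < t ] G i
subset-size []      G eq = refl
subset-size {suc t} (b ∷ S) G eq = begin
  ∣ b ∷ S ∣                  ≡⟨ head-bit b ⟩
  bit b + ∣ S ∣              ≡⟨ cong₂ _+_ (eq zero) (subset-size S (G ∘ suc) (eq ∘ suc)) ⟩
  G 0 + ∑[ i < t ] G (suc i) ≡⟨ sum-head t G ⟨
  ∑[ i < suc t ] G i         ∎
  where
  head-bit : ∀ b → ∣ b ∷ S ∣ ≡ bit b + ∣ S ∣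
  head-bit true  = refl
  head-bit false = refl

module Enumeration {p q : ℕ} (1<p : 1 < p) (1<q : 1 < q) (coprime : Coprime p q)
                   {m x y : ℕ → ℕ} (enum : IsEnumeration p q m x y) where

  instance
    p≢0 : NonZero p
    p≢0 = >-nonZero (<-trans z<s 1<p)
    q≢0 : NonZero q
    q≢0 = >-nonZero (<-trans z<s 1<q)

  P : ℕ → ℕ → ℕ
  P a b = p ^ a * q ^ b

  m-step : ∀ i → m i < m (suc i)
  m-step = proj₁ enum

  m≡P : ∀ i → m i ≡ P (x i) (y i)
  m≡P = proj₁ (proj₂ enum)

  exhaustive : ∀ a b → ∃ λ i → m i ≡ P a b
  exhaustive = proj₂ (proj₂ enum)

  m-increasing : ∀ {i j} → i < j → m i < m j
  m-increasing = increasing-by-steps m-step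

  open StrictlyIncreasing m-increasing using ()
    renaming (monotone to m-monotone; injective to m-injective; reflects-< to m-reflects-<)

  P-increasingʳ : ∀ a {b b'} → b < b' → P a b < P a b'
  P-increasingʳ a b<b' = *-monoʳ-< (p ^ a) {{m^n≢0 p a}} (^-monoʳ-< q 1<q b<b')

  P-sucˡ : ∀ a b → P (suc a) b ≡ p * P a b
  P-sucˡ a b = *-assoc p (p ^ a) (q ^ b)

  P-sucʳ : ∀ a b → P a (suc b) ≡ q * P a b
  P-sucʳ a b = x∙yz≈y∙xz (p ^ a) q (q ^ b)

  p∤q^ : ∀ b → ¬ (p ∣ q ^ b)
  p∤q^ zero    p∣1   = <⇒≢ 1<p (sym (∣1⇒≡1 p∣1))
  p∤q^ (suc b) p∣q^b = p∤q^ b (coprime-divisor coprime p∣q^b)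

  different-powers : ∀ {a b c d} → a < c → P a b ≢ P c d
  different-powers {a} {b} {c} {d} a<c eq = p∤q^ b (subst (p ∣_) (sym q^b≡) (m∣m*n _))
    where
    k : ℕ
    k = c ∸ suc a
    q^b≡ : q ^ b ≡ p * (p ^ k * q ^ d)
    q^b≡ = *-cancelˡ-≡ (q ^ b) _ (p ^ a) {{m^n≢0 p a}} (begin
      p ^ a * q ^ b                ≡⟨ eq ⟩
      p ^ c * q ^ d                ≡⟨ cong (λ e → p ^ e * q ^ d) (m+[n∸m]≡n a<c) ⟨
      p ^ (suc a + k) * q ^ d      ≡⟨ cong (_* q ^ d) (^-distribˡ-+-* p (suc a) k) ⟩
      p ^ suc a * p ^ k * q ^ d    ≡⟨ cong (λ e → e * p ^ k * q ^ d) (*-comm p (p ^ a)) ⟩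
      p ^ a * p * p ^ k * q ^ d    ≡⟨ *-assoc (p ^ a * p) (p ^ k) (q ^ d) ⟩
      p ^ a * p * (p ^ k * q ^ d)  ≡⟨ *-assoc (p ^ a) p (p ^ k * q ^ d) ⟩
      p ^ a * (p * (p ^ k * q ^ d)) ∎)

  P-injective : ∀ {a b c d} → P a b ≡ P c d → a ≡ c × b ≡ d
  P-injective {a} {b} {c} {d} eq with <-cmp a c
  ... | tri< a<c _ _ = ⊥-elim (different-powers {a} {b} {c} {d} a<c eq)
  ... | tri> _ _ c<a = ⊥-elim (different-powers {c} {d} {a} {b} c<a (sym eq))
  ... | tri≈ _ refl _ = refl , StrictlyIncreasing.injective (^-monoʳ-< q 1<q)
                                 (*-cancelˡ-≡ (q ^ b) (q ^ d) (p ^ a) {{m^n≢0 p a}} eq)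

  m0-least : ∀ a b → m 0 ≤ P a b
  m0-least a b with exhaustive a b
  ... | i , mi≡Pab = subst (m 0 ≤_) mi≡Pab (m-monotone z≤n)

  below-next : ∀ a b {t} → P a b < m (suc t) → P a b ≤ m t
  below-next a b {t} Pab<m[1+t] with exhaustive a b
  ... | i , mi≡Pab = subst (_≤ m t) mi≡Pab
                       (m-monotone (s≤s⁻¹ (m-reflects-< (subst (_< m (suc t)) (sym mi≡Pab) Pab<m[1+t]))))

  height : ℕ → ℕ → ℕ
  height t a = ∑[ i < t ] indicator (x i ≟ a)

  height-here : ∀ t → height (suc t) (x t) ≡ suc (height t (x t))
  height-here t = trans (cong (height t (x t) +_) (indicator-yes (x t ≟ x t) refl)) (+-comm _ 1)

  height-elsewhere : ∀ t {a} → a ≢ x t → height (suc t) a ≡ height t a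
  height-elsewhere t {a} a≢xt =
    trans (cong (height t a +_) (indicator-no (x t ≟ a) (a≢xt ∘ sym))) (+-identityʳ (height t a))

  Characterisation : ℕ → Set
  Characterisation t = ∀ a b → (b < height t a → P a b < m t) × (P a b < m t → b < height t a)

  top-of-column : ∀ t → Characterisation t → y t ≡ height t (x t)
  top-of-column t char with <-cmp (y t) (height t (x t))
  ... | tri< yt<h _ _ = ⊥-elim (<-irrefl (sym (m≡P t)) (proj₁ (char (x t) (y t)) yt<h))
  ... | tri≈ _ yt≡h _ = yt≡h
  ... | tri> _ _ h<yt = ⊥-elim (<-irrefl refl (proj₂ (char (x t) (height t (x t)))
                          (subst (P (x t) (height t (x t)) <_) (sym (m≡P t)) (P-increasingʳ (x t) h<yt))))

  characterisation-step : ∀ t → Characterisation t → Characterisation (suc t)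
  characterisation-step t char a b with x t ≟ a
  ... | yes refl = to , from
    where
    height≡ : height (suc t) (x t) ≡ suc (y t)
    height≡ = trans (height-here t) (cong suc (sym (top-of-column t char)))
    to : b < height (suc t) (x t) → P (x t) b < m (suc t)
    to b<h = ≤-<-trans (subst (P (x t) b ≤_) (sym (m≡P t))
                         (StrictlyIncreasing.monotone (P-increasingʳ (x t))
                            (s≤s⁻¹ (subst (b <_) height≡ b<h))))
                       (m-step t)
    from : P (x t) b < m (suc t) → b < height (suc t) (x t)
    from P<m[1+t] = subst (b <_) (sym height≡)
      (s≤s (StrictlyIncreasing.reflects-≤ (P-increasingʳ (x t))
              (subst (P (x t) b ≤_) (m≡P t) (below-next (x t) b P<m[1+t]))))
  ... | no xt≢a = to , from
    where
    to : b < height (suc t) a → P a b < m (suc t)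
    to b<h = <-trans (proj₁ (char a b) (subst (b <_) (height-elsewhere t (xt≢a ∘ sym)) b<h))
                     (m-step t)
    from : P a b < m (suc t) → b < height (suc t) a
    from P<m[1+t] with m≤n⇒m<n∨m≡n (below-next a b P<m[1+t])
    ... | inj₁ P<mt  = subst (b <_) (sym (height-elsewhere t (xt≢a ∘ sym))) (proj₂ (char a b) P<mt)
    ... | inj₂ P≡mt = ⊥-elim (xt≢a (sym (proj₁ (P-injective {a} {b} {x t} {y t} (trans P≡mt (m≡P t))))))

  characterisation : ∀ t → Characterisation t
  characterisation zero    a b = (λ ()) , (λ P<m0 → ⊥-elim (<⇒≱ P<m0 (m0-least a b)))
  characterisation (suc t) = characterisation-step t (characterisation t)

  exponent-bound : ∀ {i t} → i < t → x i < m t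
  exponent-bound {i} i<t = ≤-<-trans x≤m (m-increasing i<t)
    where
    x≤m : x i ≤ m i
    x≤m = ≤-trans (StrictlyIncreasing.≥-identity (^-monoʳ-< p 1<p) (x i))
                  (≤-trans (m≤m*n (p ^ x i) (q ^ y i) {{m^n≢0 q (y i)}}) (≤-reflexive (sym (m≡P i))))

  height-young : ∀ t → Young (m t) (height t)
  height-young t = record { nonincreasing = nonincreasing ; empty-at = empty-at }
    where
    nonincreasing : ∀ a → height t (suc a) ≤ height t a
    nonincreasing a = ≮⇒≥ λ h[a]<h[1+a] → <-irrefl refl
      (proj₂ (characterisation t a (height t a))
        (≤-<-trans (subst (P a (height t a) ≤_) (sym (P-sucˡ a (height t a))) (m≤n*m (P a (height t a)) p))
                   (proj₁ (characterisation t (suc a) (height t a)) h[a]<h[1+a])))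
    empty-at : height t (m t) ≡ 0
    empty-at = sum-zero t (λ i i<t → indicator-no (x i ≟ m t) (<⇒≢ (exponent-bound i<t)))

  sum-as-weight : ∀ n t F → (∀ i → i < t → x i < n) → ∑[ i < t ] F (x i) (y i) ≡ weight n (height t) F
  sum-as-weight n zero    F _      = sym (weight-empty n F (λ _ → refl))
  sum-as-weight n (suc t) F bounds = begin
    ∑[ i < t ] F (x i) (y i) + F (x t) (y t)
      ≡⟨ cong (_+ F (x t) (y t)) (sum-as-weight n t F (λ i → bounds i ∘ m<n⇒m<1+n)) ⟩
    weight n (height t) F + F (x t) (y t)
      ≡⟨ sum-update n (x t) (F (x t) (y t)) (bounds t ≤-refl) elsewhere here ⟨
    weight n (height (suc t)) F
      ∎
    where
    elsewhere : ∀ a → a ≢ x t → sum< (height (suc t) a) (F a) ≡ sum< (height t a) (F a)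
    elsewhere a a≢xt = cong (λ h → sum< h (F a)) (height-elsewhere t a≢xt)
    here : sum< (height (suc t) (x t)) (F (x t)) ≡ sum< (height t (x t)) (F (x t)) + F (x t) (y t)
    here = begin
      sum< (height (suc t) (x t)) (F (x t))
        ≡⟨ cong (λ h → sum< h (F (x t))) (height-here t) ⟩
      sum< (height t (x t)) (F (x t)) + F (x t) (height t (x t))
        ≡⟨ cong (λ b → _ + F (x t) b) (top-of-column t (characterisation t)) ⟨
      sum< (height t (x t)) (F (x t)) + F (x t) (y t)
        ∎

  module FirstTerms (t : ℕ) where

    occupant? : (S : Subset t) → ∀ a b → Dec (∃ λ j → j ∈ S × m (toℕ j) ≡ P a b)
    occupant? S a b = any? (λ j → (j ∈? S) ×-dec (m (toℕ j) ≟ P a b))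

    occupied : Subset t → ℕ → ℕ → ℕ
    occupied S a b = indicator (occupant? S a b)

    occupied-term : ∀ S i → bit (lookup S i) ≡ occupied S (x (toℕ i)) (y (toℕ i))
    occupied-term S i with lookup S i in Si≡
    ... | true  = sym (indicator-yes (occupant? S (x (toℕ i)) (y (toℕ i)))
                                     (i , lookup⇒[]= i S Si≡ , m≡P (toℕ i)))
    ... | false = sym (indicator-no (occupant? S (x (toℕ i)) (y (toℕ i))) not-occupied)
      where
      not-occupied : ¬ (∃ λ j → j ∈ S × m (toℕ j) ≡ P (x (toℕ i)) (y (toℕ i)))
      not-occupied (j , j∈S , mj≡) with toℕ-injective (m-injective (trans mj≡ (sym (m≡P (toℕ i)))))
      ... | refl with trans (sym ([]=⇒lookup j∈S)) Si≡
      ...   | ()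

    occupied-independent : ∀ S → QuotientFree p q m t S → Independent (occupied S)
    occupied-independent S quotient-free = record
      { at-most-one = λ a b → indicator≤1 (occupant? S a b)
      ; no-domino   = no-domino
      }
      where
      no-domino : ∀ {a b a' b'} → Adjacent a b a' b' → occupied S a b + occupied S a' b' ≤ 1
      no-domino (horizontal a b) = indicator-exclusive (occupant? S a b) (occupant? S (suc a) b)
        λ { (j , j∈S , mj≡) (j' , j'∈S , mj'≡) → proj₁ (quotient-free j' j j'∈S j∈S)
              (trans mj'≡ (trans (P-sucˡ a b) (cong (p *_) (sym mj≡)))) }
      no-domino (vertical a b) = indicator-exclusive (occupant? S a b) (occupant? S a (suc b))
        λ { (j , j∈S , mj≡) (j' , j'∈S , mj'≡) → proj₂ (quotient-free j' j j'∈S j∈S)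
              (trans mj'≡ (trans (P-sucʳ a b) (cong (q *_) (sym mj≡)))) }

    size-as-weight : ∀ (S : Subset t) G → (∀ i → bit (lookup S i) ≡ G (x (toℕ i)) (y (toℕ i))) →
                     ∣ S ∣ ≡ weight (m t) (height t) G
    size-as-weight S G records = trans (subset-size S (λ i → G (x i) (y i)) records)
                                       (sum-as-weight (m t) t G (λ _ → exponent-bound))

    class-size : ∀ c → ∣ A x y c t ∣ ≡ weight (m t) (height t) (diag (residue c))
    class-size c = size-as-weight (A x y c t) (diag (residue c))
                     (λ i → cong bit (lookup∘tabulate (λ i → does (((x (toℕ i) + y (toℕ i)) % 2) ≟ c)) i))

    upper-bound : ∀ S → QuotientFree p q m t S → ∣ S ∣ ≤ ∣ A x y 0 t ∣ ⊔ ∣ A x y 1 t ∣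
    upper-bound S quotient-free =
      subst₂ _≤_ (sym (size-as-weight S (occupied S) (occupied-term S)))
                 (sym (cong₂ _⊔_ (class-size 0) (class-size 1)))
                 (IndependenceBound.independence-bound residue-alternating
                    (occupied-independent S quotient-free) (m t) (height-young t))

    -- A colour class is quotient-free: dividing by p or q changes the parity of x + y.
    class-quotient-free : ∀ {c κ'} → Alternating (residue c) κ' → QuotientFree p q m t (A x y c t)
    class-quotient-free {c} alt u v u∈A v∈A = by-p , by-q
      where
      u' v' : ℕ
      u' = toℕ u
      v' = toℕ v
      colour : ∀ w → w ∈ A x y c t → residue c (x (toℕ w) + y (toℕ w)) ≡ 1
      colour w w∈A = cong bit (trans (sym (lookup∘tabulate _ w)) ([]=⇒lookup w∈A))
      adjacent-diagonals : x u' + y u' ≢ suc (x v' + y v')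
      adjacent-diagonals eq = 0≢1+n (begin
        0                             ≡⟨ trans (Alternating.shift alt (x v' + y v'))
                                               (alternating-exclusive alt (colour v v∈A)) ⟨
        residue c (suc (x v' + y v')) ≡⟨ cong (residue c) eq ⟨
        residue c (x u' + y u')       ≡⟨ colour u u∈A ⟩
        1                             ∎)
      by-p : ¬ (m u' ≡ p * m v')
      by-p eq with P-injective {x u'} {y u'} {suc (x v')} {y v'}
                     (trans (sym (m≡P u')) (trans eq (trans (cong (p *_) (m≡P v')) (sym (P-sucˡ (x v') (y v'))))))
      ... | xu≡ , yu≡ = adjacent-diagonals (cong₂ _+_ xu≡ yu≡)
      by-q : ¬ (m u' ≡ q * m v')
      by-q eq with P-injective {x u'} {y u'} {x v'} {suc (y v')}
                     (trans (sym (m≡P u')) (trans eq (trans (cong (q *_) (m≡P v')) (sym (P-sucʳ (x v') (y v'))))))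
      ... | xu≡ , yu≡ = adjacent-diagonals (trans (cong₂ _+_ xu≡ yu≡) (+-suc (x v') (y v')))

    lower-bound : ∃ λ S → QuotientFree p q m t S × ∣ S ∣ ≡ ∣ A x y 0 t ∣ ⊔ ∣ A x y 1 t ∣
    lower-bound with ≤-total ∣ A x y 0 t ∣ ∣ A x y 1 t ∣
    ... | inj₁ A₀≤A₁ = A x y 1 t , class-quotient-free (swap residue-alternating) , sym (m≤n⇒m⊔n≡n A₀≤A₁)
    ... | inj₂ A₁≤A₀ = A x y 0 t , class-quotient-free residue-alternating , sym (m≥n⇒m⊔n≡m A₁≤A₀)

corollary2 : (p q : ℕ) → 1 < p → p < q → gcd p q ≡ 1 →
    (m x y : ℕ → ℕ) → IsEnumeration p q m x y →
    (t : ℕ) → 1 ≤ t →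
      ((S : Subset t) → QuotientFree p q m t S → ∣ S ∣ ≤ ∣ A x y 0 t ∣ ⊔ ∣ A x y 1 t ∣) ×
      (∃ λ (S : Subset t) → QuotientFree p q m t S × ∣ S ∣ ≡ ∣ A x y 0 t ∣ ⊔ ∣ A x y 1 t ∣)
-- The statement holds for every t.
corollary2 p q 1<p p<q gcd≡1 m x y enum t _ = upper-bound , lower-bound
  where
  open Enumeration 1<p (<-trans 1<p p<q) (gcd≡1⇒coprime gcd≡1) {m} {x} {y} enum
  open FirstTerms t
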